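{- Let $k, l, m, n \ge 1$ be integers. Then $\omega^k + (\omega^*)^l + \omega^m \equiv \omega^n$ if and only if $k = l = 1$ and $m = n$. More precisely: if $m \neq n$ then $\omega^k + (\omega^*)^l + \omega^m \not\equiv_{2\min(m,n)+2} \omega^n$; if $l > 1$ then $\omega^k + (\omega^*)^l + \omega^m \not\equiv_3 \omega^n$; and if $l = 1$, $m = n$ and $k > 1$ then $\omega^k + (\omega^*)^l + \omega^m \not\equiv_6 \omega^n$.
   Context: $\omega^k$ is the ordinal power and $(\omega^*)^l$ the reverse of $\omega^l$; $+$ is concatenation. For $n \ge 1$, $X \equiv_n Y$ means player II has a winning strategy in the $n$-move Ehrenfeucht–Fraïssé game on $X$ and $Y$; $\equiv$ is elementary equivalence (i.e. $\equiv_n$ for all $n$). -}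

module Defs where

open import Data.Nat using (ℕ; zero; suc; _≤_)
import Data.Nat as N
open import Data.Vec using (Vec; []; _∷_; lookup)
open import Data.Fin using (Fin)
open import Data.Sum using (_⊎_; inj₁; inj₂)
open import Data.Product using (Σ; _×_; _,_)
open import Data.Empty using (⊥)
open import Data.Unit using (⊤)
open import Function.Bundles using (_⇔_)
open import Relation.Binary.PropositionalEquality using (_≡_)

record LinOrd : Set₁ where
  field
    Car : Set
    _≺_ : Car → Car → Set
open LinOrd public

Lex : ∀ {k} → Vec ℕ k → Vec ℕ k → Set
Lex [] [] = ⊥
Lex (x ∷ xs) (y ∷ ys) = (x N.< y) ⊎ ((x ≡ y) × Lex xs ys)

-- ω^k : ordinals below ω^k, represented by their Cantor normal form
-- digits (a_{k-1}, …, a_0), ordered lexicographically.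
ω^ : ℕ → LinOrd
ω^ k = record { Car = Vec ℕ k ; _≺_ = Lex }

rev : LinOrd → LinOrd
rev X = record { Car = Car X ; _≺_ = λ a b → _≺_ X b a }

ω*^ : ℕ → LinOrd
ω*^ l = rev (ω^ l)

SumLt : (X Y : LinOrd) → Car X ⊎ Car Y → Car X ⊎ Car Y → Set
SumLt X Y (inj₁ a) (inj₁ b) = _≺_ X a b
SumLt X Y (inj₁ a) (inj₂ b) = ⊤
SumLt X Y (inj₂ a) (inj₁ b) = ⊥
SumLt X Y (inj₂ a) (inj₂ b) = _≺_ Y a b

_⊕_ : LinOrd → LinOrd → LinOrd
X ⊕ Y = record { Car = Car X ⊎ Car Y ; _≺_ = SumLt X Y }
infixl 6 _⊕_

PartialIso : (X Y : LinOrd) {r : ℕ} → Vec (Car X) r → Vec (Car Y) r → Set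
PartialIso X Y {r} xs ys = (i j : Fin r) →
  (_≺_ X (lookup xs i) (lookup xs j) ⇔ _≺_ Y (lookup ys i) (lookup ys j))
  × (lookup xs i ≡ lookup xs j ⇔ lookup ys i ≡ lookup ys j)

IIWins : (X Y : LinOrd) (n : ℕ) {r : ℕ} → Vec (Car X) r → Vec (Car Y) r → Set
IIWins X Y zero xs ys = PartialIso X Y xs ys
IIWins X Y (suc n) xs ys =
  ((a : Car X) → Σ (Car Y) λ b → IIWins X Y n (a ∷ xs) (b ∷ ys))
  × ((b : Car Y) → Σ (Car X) λ a → IIWins X Y n (a ∷ xs) (b ∷ ys))

EFEquiv : ℕ → LinOrd → LinOrd → Set
EFEquiv n X Y = IIWins X Y n [] []

ElemEquiv : LinOrd → LinOrd → Set
ElemEquiv X Y = (n : ℕ) → 1 ≤ n → EFEquiv n X Y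

module Submission where

-- The key instance is
-- ω + ζ ≈∞ ω, where II matches signed distances up to the threshold 2^r
-- (r the number of rounds left).  Splitting off the first ω of ω^m gives
--   ω + ω* + ω^m ≅ (ω + ζ) + Rest ≈∞ ω + Rest ≅ ω^m.
--
-- Necessity, by explicit strategies for player I:
--  * m ≠ n: limit points of rank j are preserved by 2j rounds, and they are
--    unbounded in one order but not in the other (2·min(m,n) + 2 moves);
--  * l > 1: (ω*)^l has a point without immediate successor, whereas every
--    point of ω^n has one (3 moves);
--  * l = 1, k > 1: the ω^k block has points without immediate predecessor
--    below the ω* block, whose points all have one (5 moves).

open import Defs
open import Data.Nat as ℕ using (ℕ; zero; suc; z≤n; s≤s)
open import Data.Nat.Properties
open import Data.Vec using (Vec; []; _∷_; lookup; replicate; _∷ʳ_; initLast)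
open import Data.Fin using (Fin) renaming (zero to fz; suc to fs)
open import Data.List using (List; []; _∷_; map)
open import Data.List.Relation.Unary.Any using (here; there)
open import Data.List.Membership.Propositional using (_∈_)
open import Data.List.Membership.Propositional.Properties using (∈-map⁺; ∈-map⁻)
open import Data.Sum using (_⊎_; inj₁; inj₂)
open import Data.Sum.Properties using (inj₁-injective; inj₂-injective)
open import Data.Product using (Σ; _×_; _,_; proj₁; proj₂; swap)
open import Data.Empty using (⊥; ⊥-elim)
open import Data.Unit using (⊤; tt)
open import Data.Bool using (Bool; true; false; not; T)
open import Data.Bool.Properties using (T-irrelevant)
open import Function.Bundles using (_⇔_; Equivalence; mk⇔)
import Function.Properties.Equivalence as ⇔
open import Relation.Binary.PropositionalEquality
open import Relation.Binary.Definitions using (tri<; tri≈; tri>)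
open import Relation.Nullary using (¬_; Dec; yes; no)

open Equivalence

-- For the
-- back-and-forth constructions below, where invariants speak about the
-- pairs occurring in a position, this is more convenient than the indexed
-- vectors used by IIWins in Defs; the two are related by toIIWins.

Position : LinOrd → LinOrd → Set
Position X Y = List (Car X × Car Y)

IsPartialIso : (X Y : LinOrd) → Position X Y → Set
IsPartialIso X Y ps = ∀ {p q} → p ∈ ps → q ∈ ps →
  (_≺_ X (proj₁ p) (proj₁ q) ⇔ _≺_ Y (proj₂ p) (proj₂ q))
  × (proj₁ p ≡ proj₁ q ⇔ proj₂ p ≡ proj₂ q)

Wins : (X Y : LinOrd) → ℕ → Position X Y → Set
Wins X Y zero ps = IsPartialIso X Y ps
Wins X Y (suc r) ps = ((a : Car X) → Σ (Car Y) λ b → Wins X Y r ((a , b) ∷ ps))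
                    × ((b : Car Y) → Σ (Car X) λ a → Wins X Y r ((a , b) ∷ ps))

_≈∞_ : LinOrd → LinOrd → Set
X ≈∞ Y = ∀ r → Wins X Y r []

module _ {X Y : LinOrd} where

  wins-mono : ∀ r {ps} → Wins X Y (suc r) ps → Wins X Y r ps
  wins-mono zero {[]} w ()
  wins-mono zero {(x , y) ∷ ps} (forth , _) pm qm = proj₂ (forth x) (there pm) (there qm)
  wins-mono (suc r) (forth , back) =
    (λ a → let (b , w) = forth a in b , wins-mono r w) ,
    (λ b → let (a , w) = back b in a , wins-mono r w)

  wins-⊆ : ∀ r {ps qs : Position X Y} → (∀ {p} → p ∈ qs → p ∈ ps) → Wins X Y r ps → Wins X Y r qs
  wins-⊆ zero qs⊆ps w pm qm = w (qs⊆ps pm) (qs⊆ps qm)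
  wins-⊆ (suc r) {ps} {qs} qs⊆ps (forth , back) =
    (λ a → let (b , w) = forth a in b , wins-⊆ r extend w) ,
    (λ b → let (a , w) = back b in a , wins-⊆ r extend w)
    where
    extend : ∀ {x p} → p ∈ (x ∷ qs) → p ∈ (x ∷ ps)
    extend (here e) = here e
    extend (there m) = there (qs⊆ps m)

  pairs : ∀ {t} → Vec (Car X) t → Vec (Car Y) t → Position X Y
  pairs [] [] = []
  pairs (x ∷ xs) (y ∷ ys) = (x , y) ∷ pairs xs ys

  lookup∈pairs : ∀ {t} (xs : Vec (Car X) t) ys i → (lookup xs i , lookup ys i) ∈ pairs xs ys
  lookup∈pairs (x ∷ xs) (y ∷ ys) fz = here refl
  lookup∈pairs (x ∷ xs) (y ∷ ys) (fs i) = there (lookup∈pairs xs ys i)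

  toIIWins : ∀ r {t} (xs : Vec (Car X) t) ys → Wins X Y r (pairs xs ys) → IIWins X Y r xs ys
  toIIWins zero xs ys w i j = w (lookup∈pairs xs ys i) (lookup∈pairs xs ys j)
  toIIWins (suc r) xs ys (forth , back) =
    (λ a → let (b , w) = forth a in b , toIIWins r (a ∷ xs) (b ∷ ys) w) ,
    (λ b → let (a , w) = back b in a , toIIWins r (a ∷ xs) (b ∷ ys) w)

record BackAndForth (X Y : LinOrd) : Set₁ where
  field
    R : ℕ → Position X Y → Set
    base : ∀ {ps} → R zero ps → IsPartialIso X Y ps
    forth : ∀ {r ps} → R (suc r) ps → (a : Car X) → Σ (Car Y) λ b → R r ((a , b) ∷ ps)
    back : ∀ {r ps} → R (suc r) ps → (b : Car Y) → Σ (Car X) λ a → R r ((a , b) ∷ ps)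

  wins : ∀ r {ps} → R r ps → Wins X Y r ps
  wins zero h = base h
  wins (suc r) h = (λ a → let (b , h') = forth h a in b , wins r h') ,
                   (λ b → let (a , h') = back h b in a , wins r h')

record _≅_ (X Y : LinOrd) : Set where
  field
    f : Car X → Car Y
    g : Car Y → Car X
    f∘g : ∀ y → f (g y) ≡ y
    g∘f : ∀ x → g (f x) ≡ x
    f-mono : ∀ a b → _≺_ X a b → _≺_ Y (f a) (f b)
    f-reflects : ∀ a b → _≺_ Y (f a) (f b) → _≺_ X a b

≅-refl : ∀ {X} → X ≅ X
≅-refl = record { f = λ x → x ; g = λ x → x ; f∘g = λ _ → refl ; g∘f = λ _ → refl
                ; f-mono = λ _ _ l → l ; f-reflects = λ _ _ l → l }

≅-sym : ∀ {X Y} → X ≅ Y → Y ≅ X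
≅-sym {X} {Y} I = record
  { f = g ; g = f ; f∘g = g∘f ; g∘f = f∘g
  ; f-mono = λ a b l → f-reflects (g a) (g b) (subst₂ (_≺_ Y) (sym (f∘g a)) (sym (f∘g b)) l)
  ; f-reflects = λ a b l → subst₂ (_≺_ Y) (f∘g a) (f∘g b) (f-mono (g a) (g b) l) }
  where open _≅_ I

data OnGraph {A B : Set} (h : A → B) : List (A × B) → Set where
  [] : OnGraph h []
  _∷_ : ∀ {ps} a → OnGraph h ps → OnGraph h ((a , h a) ∷ ps)

onGraph-∈ : ∀ {A B : Set} {h : A → B} {ps p} → OnGraph h ps → p ∈ ps → proj₂ p ≡ h (proj₁ p)
onGraph-∈ (a ∷ _) (here refl) = refl
onGraph-∈ (_ ∷ on) (there m) = onGraph-∈ on m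

≅⇒≈∞ : ∀ {X Y} → X ≅ Y → X ≈∞ Y
≅⇒≈∞ {X} {Y} I r = BackAndForth.wins copy r []
  where
  open _≅_ I
  graphIso : ∀ {ps} → OnGraph f ps → IsPartialIso X Y ps
  graphIso on pm qm =
    let ep = onGraph-∈ on pm ; eq = onGraph-∈ on qm in
    mk⇔ (λ l → subst₂ (_≺_ Y) (sym ep) (sym eq) (f-mono _ _ l))
        (λ l → f-reflects _ _ (subst₂ (_≺_ Y) ep eq l)) ,
    mk⇔ (λ e → trans ep (trans (cong f e) (sym eq)))
        (λ e → trans (sym (g∘f _)) (trans (cong g (trans (sym ep) (trans e eq))) (g∘f _)))
  copy : BackAndForth X Y
  copy = record
    { R = λ _ ps → OnGraph f ps
    ; base = graphIso
    ; forth = λ on a → f a , a ∷ on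
    ; back = λ {_} {ps} on b → g b , subst (λ y → OnGraph f ((g b , y) ∷ ps)) (f∘g b) (g b ∷ on)
    }

-- ≈∞ is transitive: II plays two games in parallel, passing moves
-- through the middle order.
module _ {X Y Z : LinOrd} where
  private
    p₁₂ : Car X × Car Y × Car Z → Car X × Car Y
    p₁₂ (a , b , c) = a , b
    p₂₃ : Car X × Car Y × Car Z → Car Y × Car Z
    p₂₃ (a , b , c) = b , c
    p₁₃ : Car X × Car Y × Car Z → Car X × Car Z
    p₁₃ (a , b , c) = a , c

  ≈∞-trans : X ≈∞ Y → Y ≈∞ Z → X ≈∞ Z
  ≈∞-trans h₁ h₂ r = BackAndForth.wins composite r ([] , refl , h₁ r , h₂ r)
    where
    composeIso : ∀ ts → IsPartialIso X Y (map p₁₂ ts) → IsPartialIso Y Z (map p₂₃ ts) →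
                 IsPartialIso X Z (map p₁₃ ts)
    composeIso ts w₁ w₂ pm qm with ∈-map⁻ p₁₃ pm | ∈-map⁻ p₁₃ qm
    ... | (t , tm , refl) | (t' , tm' , refl) =
      let (o₁ , e₁) = w₁ (∈-map⁺ p₁₂ tm) (∈-map⁺ p₁₂ tm')
          (o₂ , e₂) = w₂ (∈-map⁺ p₂₃ tm) (∈-map⁺ p₂₃ tm')
      in ⇔.trans o₁ o₂ , ⇔.trans e₁ e₂
    composite : BackAndForth X Z
    composite = record
      { R = λ r ps → Σ (List (Car X × Car Y × Car Z)) λ ts →
              map p₁₃ ts ≡ ps × Wins X Y r (map p₁₂ ts) × Wins Y Z r (map p₂₃ ts)
      ; base = λ { (ts , refl , w₁ , w₂) → composeIso ts w₁ w₂ }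
      ; forth = λ { (ts , refl , (f₁ , _) , (f₂ , _)) a →
          let (b , w₁) = f₁ a ; (c , w₂) = f₂ b in c , ((a , b , c) ∷ ts) , refl , w₁ , w₂ }
      ; back = λ { (ts , refl , (_ , g₁) , (_ , g₂)) c →
          let (b , w₂) = g₂ c ; (a , w₁) = g₁ b in a , ((a , b , c) ∷ ts) , refl , w₁ , w₂ }
      }

-- ≈∞ is a congruence for concatenation: II answers moves in each summand
-- by the strategy for that summand.
module _ {A A' B B' : LinOrd} where
  private
    inL : Car A × Car A' → Car (A ⊕ B) × Car (A' ⊕ B')
    inL (a , a') = inj₁ a , inj₁ a'
    inR : Car B × Car B' → Car (A ⊕ B) × Car (A' ⊕ B')
    inR (b , b') = inj₂ b , inj₂ b'

    lift⇔₁ : ∀ {x y : Car A} {x' y' : Car A'} → (x ≡ y ⇔ x' ≡ y') →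
             (_≡_ {A = Car (A ⊕ B)} (inj₁ x) (inj₁ y) ⇔ _≡_ {A = Car (A' ⊕ B')} (inj₁ x') (inj₁ y'))
    lift⇔₁ e = mk⇔ (λ q → cong inj₁ (to e (inj₁-injective q))) (λ q → cong inj₁ (from e (inj₁-injective q)))

    lift⇔₂ : ∀ {x y : Car B} {x' y' : Car B'} → (x ≡ y ⇔ x' ≡ y') →
             (_≡_ {A = Car (A ⊕ B)} (inj₂ x) (inj₂ y) ⇔ _≡_ {A = Car (A' ⊕ B')} (inj₂ x') (inj₂ y'))
    lift⇔₂ e = mk⇔ (λ q → cong inj₂ (to e (inj₂-injective q))) (λ q → cong inj₂ (from e (inj₂-injective q)))

    Splits : Position (A ⊕ B) (A' ⊕ B') → Position A A' → Position B B' → Set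
    Splits ps ls rs = ∀ {p} → p ∈ ps → p ∈ map inL ls ⊎ p ∈ map inR rs

    splitIso : ∀ ps ls rs → Splits ps ls rs → IsPartialIso A A' ls → IsPartialIso B B' rs →
               IsPartialIso (A ⊕ B) (A' ⊕ B') ps
    splitIso ps ls rs split wl wr pm qm with split pm | split qm
    ... | inj₁ pl | inj₁ ql with ∈-map⁻ inL pl | ∈-map⁻ inL ql
    ...   | (_ , al , refl) | (_ , cl , refl) = let (o , e) = wl al cl in o , lift⇔₁ e
    splitIso ps ls rs split wl wr pm qm | inj₁ pl | inj₂ qr with ∈-map⁻ inL pl | ∈-map⁻ inR qr
    ...   | (_ , _ , refl) | (_ , _ , refl) = mk⇔ (λ _ → tt) (λ _ → tt) , mk⇔ (λ ()) (λ ())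
    splitIso ps ls rs split wl wr pm qm | inj₂ pr | inj₁ ql with ∈-map⁻ inR pr | ∈-map⁻ inL ql
    ...   | (_ , _ , refl) | (_ , _ , refl) = mk⇔ (λ ()) (λ ()) , mk⇔ (λ ()) (λ ())
    splitIso ps ls rs split wl wr pm qm | inj₂ pr | inj₂ qr with ∈-map⁻ inR pr | ∈-map⁻ inR qr
    ...   | (_ , br , refl) | (_ , dr , refl) = let (o , e) = wr br dr in o , lift⇔₂ e

    addL : ∀ {ps ls rs} x → Splits ps ls rs → Splits (inL x ∷ ps) (x ∷ ls) rs
    addL x split (here refl) = inj₁ (here refl)
    addL x split (there m) with split m
    ... | inj₁ l = inj₁ (there l)
    ... | inj₂ r = inj₂ r

    addR : ∀ {ps ls rs} x → Splits ps ls rs → Splits (inR x ∷ ps) ls (x ∷ rs)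
    addR x split (here refl) = inj₂ (here refl)
    addR x split (there m) with split m
    ... | inj₁ l = inj₁ l
    ... | inj₂ r = inj₂ (there r)

  ≈∞-⊕ : A ≈∞ A' → B ≈∞ B' → (A ⊕ B) ≈∞ (A' ⊕ B')
  ≈∞-⊕ h₁ h₂ r = BackAndForth.wins summandwise r ([] , [] , (λ ()) , h₁ r , h₂ r)
    where
    summandwise : BackAndForth (A ⊕ B) (A' ⊕ B')
    summandwise = record
      { R = λ r ps → Σ (Position A A') λ ls → Σ (Position B B') λ rs →
              Splits ps ls rs × Wins A A' r ls × Wins B B' r rs
      ; base = λ { {ps} (ls , rs , split , wl , wr) → splitIso ps ls rs split wl wr }
      ; forth = λ
          { {r} (ls , rs , split , (fl , _) , wr) (inj₁ a) → let (a' , w) = fl a in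
              inj₁ a' , _ , rs , addL (a , a') split , w , wins-mono r wr
          ; {r} (ls , rs , split , wl , (fr , _)) (inj₂ b) → let (b' , w) = fr b in
              inj₂ b' , ls , _ , addR (b , b') split , wins-mono r wl , w }
      ; back = λ
          { {r} (ls , rs , split , (_ , gl) , wr) (inj₁ a') → let (a , w) = gl a' in
              inj₁ a , _ , rs , addL (a , a') split , w , wins-mono r wr
          ; {r} (ls , rs , split , wl , (_ , gr)) (inj₂ b') → let (b , w) = gr b' in
              inj₂ b , ls , _ , addR (b , b') split , wins-mono r wl , w }
      }

-- Points of ω + ζ are compared through
-- their signed distance, an integer inside a block and ±∞ across blocks.
-- Player II keeps the invariant that corresponding distances agree
-- exactly or are both beyond ±T, where T = 2^r when r rounds remain: a new
-- point close to an old one is copied at the same distance, a point far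
-- from all old ones is matched by a point far from all old ones on the
-- same side.  Since T ≥ 1 at the end, the final position preserves order.
module ω+ζ≈ω where

  open import Data.Integer using (ℤ; +_; _+_; _-_; -_; _≤_; _<_; ∣_∣; +≤+; +<+; 0ℤ; 1ℤ)
  import Data.Integer.Properties as ℤₚ
  open import Data.Integer.Tactic.RingSolver using (solve-∀)

  data ℤ∞ : Set where
    fin : ℤ → ℤ∞
    +∞ -∞ : ℤ∞

  neg : ℤ∞ → ℤ∞
  neg (fin e) = fin (- e)
  neg +∞ = -∞
  neg -∞ = +∞

  -- Distances measured from a point that lies δ further right.
  shift : ℤ∞ → ℤ → ℤ∞
  shift (fin e) δ = fin (e - δ)
  shift +∞ δ = +∞
  shift -∞ δ = -∞

  Big : ℕ → ℤ∞ → Set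
  Big T (fin e) = + T ≤ e
  Big T +∞ = ⊤
  Big T -∞ = ⊥

  Small : ℕ → ℤ∞ → Set
  Small T (fin e) = e ≤ - + T
  Small T +∞ = ⊥
  Small T -∞ = ⊤

  Far : ℕ → ℤ∞ → Set
  Far T e = Big T e ⊎ Small T e

  Near : ℕ → ℤ → Set
  Near T δ = (- + T < δ) × (δ < + T)

  _≈[_]_ : ℤ∞ → ℕ → ℤ∞ → Set
  e ≈[ T ] e' = (e ≡ e') ⊎ ((Big T e × Big T e') ⊎ (Small T e × Small T e'))

  sub-antisym : ∀ a b → a - b ≡ - (b - a)
  sub-antisym = solve-∀

  sub-rebase : ∀ i j k → k - j ≡ (k - i) - (j - i)
  sub-rebase = solve-∀

  add-sub : ∀ i δ → (i + δ) - i ≡ δ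
  add-sub = solve-∀

  two-steps : ∀ i j k t → (k - i) - (t + t) ≡ (j - i - t) + (k - j - t)
  two-steps = solve-∀

  ≤-by-difference : ∀ {a b} x → b - a ≡ x → 0ℤ ≤ x → a ≤ b
  ≤-by-difference x e h = ℤₚ.0≤i-j⇒j≤i (subst (0ℤ ≤_) (sym e) h)

  big⇒small-neg : ∀ {T} e → Big T e → Small T (neg e)
  big⇒small-neg (fin e) h = ℤₚ.neg-mono-≤ h
  big⇒small-neg +∞ h = tt

  small⇒big-neg : ∀ {T} e → Small T e → Big T (neg e)
  small⇒big-neg {T} (fin e) h = subst (_≤ - e) (ℤₚ.neg-involutive (+ T)) (ℤₚ.neg-mono-≤ h)
  small⇒big-neg -∞ h = tt

  big-mono : ∀ {S T} → S ℕ.≤ T → ∀ e → Big T e → Big S e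
  big-mono le (fin e) h = ℤₚ.≤-trans (+≤+ le) h
  big-mono le +∞ h = tt

  small-mono : ∀ {S T} → S ℕ.≤ T → ∀ e → Small T e → Small S e
  small-mono le (fin e) h = ℤₚ.≤-trans h (ℤₚ.neg-mono-≤ (+≤+ le))
  small-mono le -∞ h = tt

  big-small-disjoint : ∀ {S T} → 1 ℕ.≤ T → ∀ e → Big S e → Small T e → ⊥
  big-small-disjoint {S} {suc T} _ (fin e) b s with ℤₚ.≤-trans (ℤₚ.≤-trans (+≤+ z≤n) b) s
  ... | ()

  ≈-sym : ∀ {T e e'} → e ≈[ T ] e' → e' ≈[ T ] e
  ≈-sym (inj₁ p) = inj₁ (sym p)
  ≈-sym (inj₂ (inj₁ (a , b))) = inj₂ (inj₁ (b , a))
  ≈-sym (inj₂ (inj₂ (a , b))) = inj₂ (inj₂ (b , a))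

  ≈-neg : ∀ {T e e'} → e ≈[ T ] e' → neg e ≈[ T ] neg e'
  ≈-neg (inj₁ p) = inj₁ (cong neg p)
  ≈-neg {e = e} {e'} (inj₂ (inj₁ (a , b))) = inj₂ (inj₂ (big⇒small-neg e a , big⇒small-neg e' b))
  ≈-neg {e = e} {e'} (inj₂ (inj₂ (a , b))) = inj₂ (inj₁ (small⇒big-neg e a , small⇒big-neg e' b))

  ≈-mono : ∀ {S T e e'} → S ℕ.≤ T → e ≈[ T ] e' → e ≈[ S ] e'
  ≈-mono le (inj₁ p) = inj₁ p
  ≈-mono {e = e} {e'} le (inj₂ (inj₁ (a , b))) = inj₂ (inj₁ (big-mono le e a , big-mono le e' b))
  ≈-mono {e = e} {e'} le (inj₂ (inj₂ (a , b))) = inj₂ (inj₂ (small-mono le e a , small-mono le e' b))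

  ≈-big : ∀ {S T} → S ℕ.≤ T → 1 ℕ.≤ T → ∀ {e e'} → e ≈[ T ] e' → Big S e → Big S e'
  ≈-big le t (inj₁ refl) h = h
  ≈-big le t {e' = e'} (inj₂ (inj₁ (_ , b))) h = big-mono le e' b
  ≈-big le t {e} (inj₂ (inj₂ (s , _))) h = ⊥-elim (big-small-disjoint t e h s)

  shift-big : ∀ {T} e δ → Big (T ℕ.+ T) e → δ ≤ + T → Big T (shift e δ)
  shift-big {T} (fin e) δ h₁ h₂ =
    ≤-by-difference ((e - + (T ℕ.+ T)) + (+ T - δ)) (eq e δ (+ T))
      (ℤₚ.+-mono-≤ (ℤₚ.i≤j⇒0≤j-i h₁) (ℤₚ.i≤j⇒0≤j-i h₂))
    where
    eq : ∀ e δ t → (e - δ) - t ≡ (e - (t + t)) + (t - δ)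
    eq = solve-∀
  shift-big +∞ δ h₁ h₂ = tt

  shift-small : ∀ {T} e δ → Small (T ℕ.+ T) e → - + T ≤ δ → Small T (shift e δ)
  shift-small {T} (fin e) δ h₁ h₂ =
    ≤-by-difference ((- (+ T + + T) - e) + (δ - - + T)) (eq e δ (+ T))
      (ℤₚ.+-mono-≤ (ℤₚ.i≤j⇒0≤j-i h₁) (ℤₚ.i≤j⇒0≤j-i h₂))
    where
    eq : ∀ e δ t → (- t) - (e - δ) ≡ (- (t + t) - e) + (δ - - t)
    eq = solve-∀
  shift-small -∞ δ h₁ h₂ = tt

  ≈-shift : ∀ {T e e'} δ → e ≈[ T ℕ.+ T ] e' → Near T δ → shift e δ ≈[ T ] shift e' δ
  ≈-shift δ (inj₁ p) _ = inj₁ (cong (λ x → shift x δ) p)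
  ≈-shift {e = e} {e'} δ (inj₂ (inj₁ (a , b))) (_ , δ<T) =
    inj₂ (inj₁ (shift-big e δ a (ℤₚ.<⇒≤ δ<T) , shift-big e' δ b (ℤₚ.<⇒≤ δ<T)))
  ≈-shift {e = e} {e'} δ (inj₂ (inj₂ (a , b))) (-T<δ , _) =
    inj₂ (inj₂ (shift-small e δ a (ℤₚ.<⇒≤ -T<δ) , shift-small e' δ b (ℤₚ.<⇒≤ -T<δ)))

  near-or-far : ∀ T e → Far T e ⊎ Σ ℤ (λ δ → e ≡ fin δ × Near T δ)
  near-or-far T +∞ = inj₁ (inj₁ tt)
  near-or-far T -∞ = inj₁ (inj₂ tt)
  near-or-far T (fin δ) with + T ℤₚ.≤? δ
  ... | yes h = inj₁ (inj₁ h)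
  ... | no h with δ ℤₚ.≤? - + T
  ...   | yes h' = inj₁ (inj₂ h')
  ...   | no h' = inj₂ (δ , refl , ℤₚ.≰⇒> h' , ℤₚ.≰⇒> h)

  zero-not-far : ∀ {T} → 1 ℕ.≤ T → Far T (fin 0ℤ) → ⊥
  zero-not-far {suc T} _ (inj₁ (+≤+ ()))
  zero-not-far {suc T} _ (inj₂ ())

  far-neg : ∀ {T} e → Far T (neg e) → Far T e
  far-neg (fin e) (inj₁ b) = inj₂ (subst (λ x → x ≤ - + _) (ℤₚ.neg-involutive e) (ℤₚ.neg-mono-≤ b))
  far-neg (fin e) (inj₂ s) = inj₁ (subst (_ ≤_) (ℤₚ.neg-involutive e) (small⇒big-neg (fin (- e)) s))
  far-neg +∞ _ = inj₁ tt
  far-neg -∞ _ = inj₂ tt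

  zero-big₁ : ∀ e → Big 1 e → e ≢ fin 0ℤ
  zero-big₁ (fin _) (+≤+ ()) refl

  zero-small₁ : ∀ e → Small 1 e → e ≢ fin 0ℤ
  zero-small₁ (fin _) () refl

  ≈₁⇒same-sign : ∀ {e e'} → e ≈[ 1 ] e' → (Big 1 e ⇔ Big 1 e') × (e ≡ fin 0ℤ ⇔ e' ≡ fin 0ℤ)
  ≈₁⇒same-sign (inj₁ refl) = ⇔.refl , ⇔.refl
  ≈₁⇒same-sign {e} {e'} (inj₂ (inj₁ (a , b))) =
    mk⇔ (λ _ → b) (λ _ → a) ,
    mk⇔ (λ z → ⊥-elim (zero-big₁ e a z)) (λ z → ⊥-elim (zero-big₁ e' b z))
  ≈₁⇒same-sign {e} {e'} (inj₂ (inj₂ (a , b))) =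
    mk⇔ (λ p → ⊥-elim (big-small-disjoint ≤-refl e p a)) (λ p → ⊥-elim (big-small-disjoint ≤-refl e' p b)) ,
    mk⇔ (λ z → ⊥-elim (zero-small₁ e a z)) (λ z → ⊥-elim (zero-small₁ e' b z))

  ω : LinOrd
  ω = record { Car = ℕ ; _≺_ = ℕ._<_ }

  ζ : LinOrd
  ζ = record { Car = ℤ ; _≺_ = _<_ }

  ω+ζ : LinOrd
  ω+ζ = ω ⊕ ζ

  Pt : Set
  Pt = Car ω+ζ

  _≺ₖ_ : Pt → Pt → Set
  _≺ₖ_ = _≺_ ω+ζ

  origin : Pt
  origin = inj₁ 0

  dist : Pt → Pt → ℤ∞
  dist (inj₁ i) (inj₁ j) = fin (+ j - + i)
  dist (inj₁ i) (inj₂ z) = +∞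
  dist (inj₂ z) (inj₁ j) = -∞
  dist (inj₂ z) (inj₂ w) = fin (w - z)

  dist-antisym : ∀ u v → dist v u ≡ neg (dist u v)
  dist-antisym (inj₁ i) (inj₁ j) = cong fin (sub-antisym (+ i) (+ j))
  dist-antisym (inj₁ i) (inj₂ z) = refl
  dist-antisym (inj₂ z) (inj₁ j) = refl
  dist-antisym (inj₂ z) (inj₂ w) = cong fin (sub-antisym z w)

  dist-self : ∀ u → dist u u ≡ fin 0ℤ
  dist-self (inj₁ i) = cong fin (ℤₚ.+-inverseʳ (+ i))
  dist-self (inj₂ z) = cong fin (ℤₚ.+-inverseʳ z)

  dist-shift : ∀ x a δ → dist x a ≡ fin δ → ∀ w → dist a w ≡ shift (dist x w) δ
  dist-shift (inj₁ i) (inj₁ j) δ refl (inj₁ k) = cong fin (sub-rebase (+ i) (+ j) (+ k))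
  dist-shift (inj₁ i) (inj₁ j) δ refl (inj₂ z) = refl
  dist-shift (inj₂ z) (inj₂ z') δ refl (inj₁ k) = refl
  dist-shift (inj₂ i) (inj₂ j) δ refl (inj₂ k) = cong fin (sub-rebase i j k)

  <⇔difference-pos : ∀ a b → (a < b) ⇔ (+ 1 ≤ b - a)
  <⇔difference-pos a b =
    mk⇔ (λ l → ≤-by-difference (b - (1ℤ + a)) (sym (eq a b)) (ℤₚ.i≤j⇒0≤j-i (ℤₚ.i<j⇒suc[i]≤j l)))
        (λ h → ℤₚ.suc[i]≤j⇒i<j (≤-by-difference ((b - a) - 1ℤ) (eq a b) (ℤₚ.i≤j⇒0≤j-i h)))
    where
    eq : ∀ a b → b - (1ℤ + a) ≡ (b - a) - 1ℤ
    eq = solve-∀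

  ≺⇔dist-pos : ∀ x y → (x ≺ₖ y) ⇔ Big 1 (dist x y)
  ≺⇔dist-pos (inj₁ i) (inj₁ j) =
    ⇔.trans (mk⇔ +<+ ℤₚ.drop‿+<+) (<⇔difference-pos (+ i) (+ j))
  ≺⇔dist-pos (inj₁ i) (inj₂ z) = mk⇔ (λ _ → tt) (λ _ → tt)
  ≺⇔dist-pos (inj₂ z) (inj₁ j) = mk⇔ (λ ()) (λ ())
  ≺⇔dist-pos (inj₂ z) (inj₂ w) = <⇔difference-pos z w

  fin-injective : ∀ {a b} → fin a ≡ fin b → a ≡ b
  fin-injective refl = refl

  ≡⇔dist-zero : ∀ x y → (x ≡ y) ⇔ (dist x y ≡ fin 0ℤ)
  ≡⇔dist-zero (inj₁ i) (inj₁ j) = mk⇔ (λ { refl → dist-self (inj₁ i) })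
    (λ e → cong inj₁ (sym (ℤₚ.+-injective (ℤₚ.i-j≡0⇒i≡j (+ j) (+ i) (fin-injective e)))))
  ≡⇔dist-zero (inj₁ i) (inj₂ z) = mk⇔ (λ ()) (λ ())
  ≡⇔dist-zero (inj₂ z) (inj₁ j) = mk⇔ (λ ()) (λ ())
  ≡⇔dist-zero (inj₂ z) (inj₂ w) = mk⇔ (λ { refl → dist-self (inj₂ z) })
    (λ e → cong inj₂ (sym (ℤₚ.i-j≡0⇒i≡j w z (fin-injective e))))

  ≺ₖ-trichotomy : ∀ x y → (x ≺ₖ y) ⊎ ((x ≡ y) ⊎ (y ≺ₖ x))
  ≺ₖ-trichotomy (inj₁ i) (inj₁ j) with <-cmp i j
  ... | tri< a _ _ = inj₁ a
  ... | tri≈ _ e _ = inj₂ (inj₁ (cong inj₁ e))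
  ... | tri> _ _ c = inj₂ (inj₂ c)
  ≺ₖ-trichotomy (inj₁ i) (inj₂ z) = inj₁ tt
  ≺ₖ-trichotomy (inj₂ z) (inj₁ j) = inj₂ (inj₂ tt)
  ≺ₖ-trichotomy (inj₂ z) (inj₂ w) with ℤₚ.<-cmp z w
  ... | tri< a _ _ = inj₁ a
  ... | tri≈ _ e _ = inj₂ (inj₁ (cong inj₂ e))
  ... | tri> _ _ c = inj₂ (inj₂ c)

  ≺ₖ-irrefl : ∀ x → ¬ (x ≺ₖ x)
  ≺ₖ-irrefl (inj₁ i) l = <-irrefl refl l
  ≺ₖ-irrefl (inj₂ z) l = ℤₚ.<-irrefl refl l

  ≺ₖ-trans : ∀ x y z → x ≺ₖ y → y ≺ₖ z → x ≺ₖ z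
  ≺ₖ-trans (inj₁ x) (inj₁ y) (inj₁ z) a b = <-trans a b
  ≺ₖ-trans (inj₁ x) (inj₁ y) (inj₂ z) a b = tt
  ≺ₖ-trans (inj₁ x) (inj₂ y) (inj₂ z) a b = tt
  ≺ₖ-trans (inj₂ x) (inj₂ y) (inj₂ z) a b = ℤₚ.<-trans a b
  ≺ₖ-trans (inj₁ x) (inj₂ y) (inj₁ z) a ()
  ≺ₖ-trans (inj₂ x) (inj₁ y) z () b
  ≺ₖ-trans (inj₂ x) (inj₂ y) (inj₁ z) a ()

  ≺ₖ-dec : ∀ x y → Dec (x ≺ₖ y)
  ≺ₖ-dec x y with ≺ₖ-trichotomy x y
  ... | inj₁ a = yes a
  ... | inj₂ (inj₁ refl) = no (≺ₖ-irrefl x)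
  ... | inj₂ (inj₂ c) = no (λ a → ≺ₖ-irrefl x (≺ₖ-trans x y x a c))

  origin-least : ∀ a → (origin ≺ₖ a) ⊎ (a ≡ origin)
  origin-least (inj₁ zero) = inj₂ refl
  origin-least (inj₁ (suc i)) = inj₁ (s≤s z≤n)
  origin-least (inj₂ z) = inj₁ tt

  ⊀⇒dist-nonneg : ∀ u v → ¬ (u ≺ₖ v) → Big 0 (dist v u)
  ⊀⇒dist-nonneg u v u⊀v with ≺ₖ-trichotomy v u
  ... | inj₁ a = big-mono z≤n (dist v u) (to (≺⇔dist-pos v u) a)
  ... | inj₂ (inj₁ refl) = subst (Big 0) (sym (dist-self u)) (+≤+ z≤n)
  ... | inj₂ (inj₂ c) = ⊥-elim (u⊀v c)

  big-add : ∀ {T} u v w → Big T (dist u v) → Big T (dist v w) → Big (T ℕ.+ T) (dist u w)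
  big-add {T} (inj₁ i) (inj₁ j) (inj₁ k) a b =
    ≤-by-difference ((+ j - + i - + T) + (+ k - + j - + T)) (two-steps (+ i) (+ j) (+ k) (+ T))
      (ℤₚ.+-mono-≤ (ℤₚ.i≤j⇒0≤j-i a) (ℤₚ.i≤j⇒0≤j-i b))
  big-add (inj₁ i) (inj₁ j) (inj₂ k) a b = tt
  big-add (inj₁ i) (inj₂ j) (inj₁ k) a ()
  big-add (inj₁ i) (inj₂ j) (inj₂ k) a b = tt
  big-add (inj₂ i) (inj₁ j) w () b
  big-add (inj₂ i) (inj₂ j) (inj₁ k) a ()
  big-add {T} (inj₂ i) (inj₂ j) (inj₂ k) a b =
    ≤-by-difference ((j - i - + T) + (k - j - + T)) (two-steps i j k (+ T))
      (ℤₚ.+-mono-≤ (ℤₚ.i≤j⇒0≤j-i a) (ℤₚ.i≤j⇒0≤j-i b))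

  -- Moving a point by δ; inside ω this must not go below 0.
  Movable : Pt → ℤ → Set
  Movable (inj₁ i) δ = 0ℤ ≤ + i + δ
  Movable (inj₂ z) δ = ⊤

  move : (x : Pt) (δ : ℤ) → Movable x δ → Pt
  move (inj₁ i) δ h = inj₁ ∣ + i + δ ∣
  move (inj₂ z) δ h = inj₂ (z + δ)

  dist-move : ∀ x δ h → dist x (move x δ h) ≡ fin δ
  dist-move (inj₁ i) δ h = cong fin (trans (cong (_- + i) (ℤₚ.0≤i⇒+∣i∣≡i h)) (add-sub (+ i) δ))
  dist-move (inj₂ z) δ h = cong fin (add-sub z δ)

  movable-right : ∀ x t → Movable x (+ t)
  movable-right (inj₁ i) t = +≤+ z≤n
  movable-right (inj₂ z) t = tt

  movable-by-dist : ∀ x a δ → dist x a ≡ fin δ → Movable x δ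
  movable-by-dist (inj₁ i) (inj₁ j) δ refl = subst (0ℤ ≤_) (eq (+ i) (+ j)) (+≤+ z≤n)
    where
    eq : ∀ i j → j ≡ i + (j - i)
    eq = solve-∀
  movable-by-dist (inj₂ z) a δ e = tt

  movable-far : ∀ {T} i δ → + (T ℕ.+ T) ≤ + i - 0ℤ → Near T δ → Movable (inj₁ i) δ
  movable-far {T} i δ far (-T<δ , _) =
    ≤-by-difference (((+ i - 0ℤ) - + (T ℕ.+ T)) + (δ - - + T) + + T) (eq (+ i) δ (+ T))
      (ℤₚ.+-mono-≤ (ℤₚ.+-mono-≤ (ℤₚ.i≤j⇒0≤j-i far) (ℤₚ.i≤j⇒0≤j-i (ℤₚ.<⇒≤ -T<δ))) (+≤+ z≤n))
    where
    eq : ∀ i δ t → (i + δ) - 0ℤ ≡ ((i - 0ℤ) - (t + t)) + (δ - - t) + t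
    eq = solve-∀

  movable-transfer : ∀ {T} → 1 ℕ.≤ T → (x y : Pt) (δ : ℤ) →
    dist origin x ≈[ T ℕ.+ T ] dist origin y → Movable x δ → Near T δ → Movable y δ
  movable-transfer t x (inj₂ z) δ _ _ _ = tt
  movable-transfer t (inj₁ j) (inj₁ i) δ (inj₁ e) h _ =
    subst (λ u → 0ℤ ≤ u + δ) (trans (sym (ℤₚ.+-identityʳ (+ j)))
      (trans (fin-injective e) (ℤₚ.+-identityʳ (+ i)))) h
  movable-transfer t x (inj₁ i) δ (inj₂ (inj₁ (_ , b))) h near = movable-far i δ b near
  movable-transfer {T} t x (inj₁ i) δ (inj₂ (inj₂ (_ , s))) h _ =
    ⊥-elim (big-small-disjoint (≤-trans t (m≤m+n T T)) (fin (+ i - 0ℤ)) (+≤+ z≤n) s)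

  InOmega : Pt → Set
  InOmega (inj₁ _) = ⊤
  InOmega (inj₂ _) = ⊥

  move-in-ω : ∀ x δ h → InOmega x → InOmega (move x δ h)
  move-in-ω (inj₁ i) δ h _ = tt

  Pos : Set
  Pos = List (Pt × Pt)

  Similar : ℕ → Pos → Set
  Similar T ps = ∀ {p q} → p ∈ ps → q ∈ ps →
    dist (proj₁ p) (proj₁ q) ≈[ T ] dist (proj₂ p) (proj₂ q)

  Good : ℕ → Pos → Set
  Good T ps = ((origin , origin) ∈ ps) × Similar T ps

  good-∷ : ∀ {S T} → S ℕ.≤ T → ∀ {ps} a b → Good T ps →
           (∀ {q} → q ∈ ps → dist a (proj₁ q) ≈[ S ] dist b (proj₂ q)) → Good S ((a , b) ∷ ps)
  good-∷ {S} le {ps} a b (o∈ps , sim) new = there o∈ps , sim'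
    where
    sim' : Similar S ((a , b) ∷ ps)
    sim' (here refl) (here refl) = inj₁ (trans (dist-self a) (sym (dist-self b)))
    sim' (here refl) (there qm) = new qm
    sim' {p} (there pm) (here refl) =
      subst₂ _≈[ S ]_ (sym (dist-antisym a (proj₁ p))) (sym (dist-antisym b (proj₂ p))) (≈-neg (new pm))
    sim' (there pm) (there qm) = ≈-mono le (sim pm qm)

  near-or-far-from : ∀ T a (ps : Pos) →
    (Σ (Pt × Pt) λ q → q ∈ ps × Σ ℤ (λ δ → dist (proj₁ q) a ≡ fin δ × Near T δ)) ⊎
    (∀ {q} → q ∈ ps → Far T (dist (proj₁ q) a))
  near-or-far-from T a [] = inj₂ (λ ())
  near-or-far-from T a (p ∷ ps) with near-or-far T (dist (proj₁ p) a)
  ... | inj₂ (δ , e , near) = inj₁ (p , here refl , δ , e , near)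
  ... | inj₁ far with near-or-far-from T a ps
  ...   | inj₁ (q , qm , r) = inj₁ (q , there qm , r)
  ...   | inj₂ h = inj₂ (λ { (here refl) → far ; (there qm) → h qm })

  LargestBelow : Pt → Pos → Pt × Pt → Set
  LargestBelow a ps L = L ∈ ps × (proj₁ L ≺ₖ a) ×
    (∀ {q} → q ∈ ps → proj₁ q ≺ₖ a → ¬ (proj₁ L ≺ₖ proj₁ q))

  largest-below : ∀ a (ps : Pos) → (∀ {q} → q ∈ ps → ¬ (proj₁ q ≺ₖ a)) ⊎ Σ (Pt × Pt) (LargestBelow a ps)
  largest-below a [] = inj₁ (λ ())
  largest-below a (p ∷ ps) with ≺ₖ-dec (proj₁ p) a | largest-below a ps
  ... | no p⊀a | inj₁ none = inj₁ (λ { (here refl) → p⊀a ; (there m) → none m })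
  ... | no p⊀a | inj₂ (L , L∈ , La , top) =
    inj₂ (L , (there L∈ , La , λ { (here refl) pa → ⊥-elim (p⊀a pa) ; (there m) → top m }))
  ... | yes pa | inj₁ none =
    inj₂ (p , (here refl , pa , λ { (here refl) _ → ≺ₖ-irrefl (proj₁ p) ; (there m) qa → ⊥-elim (none m qa) }))
  ... | yes pa | inj₂ (L , L∈ , La , top) with ≺ₖ-dec (proj₁ L) (proj₁ p)
  ...   | yes Lp = inj₂ (p , (here refl , pa , λ
            { (here refl) _ → ≺ₖ-irrefl (proj₁ p)
            ; {q} (there m) qa pq → top m qa (≺ₖ-trans (proj₁ L) (proj₁ p) (proj₁ q) Lp pq) }))
  ...   | no L⊀p = inj₂ (L , (there L∈ , La , λ { (here refl) _ → L⊀p ; (there m) → top m }))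

  shift-neg-nonneg : ∀ {T} e → Big 0 e → Small T (shift (neg e) (+ T))
  shift-neg-nonneg {T} (fin e) h = ≤-by-difference e (eq e (+ T)) h
    where
    eq : ∀ e t → (- t) - (- e - t) ≡ e
    eq = solve-∀
  shift-neg-nonneg +∞ h = tt

  -- One move of player I on the left (a) answered by II on the right,
  -- halving the scale from 2T to T.  The answer stays in ω whenever the
  -- right-hand points of the position do.
  module Answer (T : ℕ) (t : 1 ℕ.≤ T) (ps : Pos) (good : Good (T ℕ.+ T) ps) (a : Pt) where

    private
      sim : Similar (T ℕ.+ T) ps
      sim = proj₂ good

      1≤2T : 1 ℕ.≤ T ℕ.+ T
      1≤2T = ≤-trans t (m≤m+n T T)

    Answered : Set
    Answered = Σ Pt λ b → Good T ((a , b) ∷ ps) × ((∀ {q} → q ∈ ps → InOmega (proj₂ q)) → InOmega b)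

    -- a lies at a small distance δ from an old point: copy that offset.
    near-answer : ∀ q → q ∈ ps → ∀ δ → dist (proj₁ q) a ≡ fin δ → Near T δ → Answered
    near-answer (x , y) q∈ δ e near =
      let mx = movable-by-dist x a δ e
          my = movable-transfer t x y δ (sim (proj₁ good) q∈) mx near
          b = move y δ my
      in b ,
         good-∷ (m≤n+m T T) a b good (λ {q'} q'∈ →
           subst₂ _≈[ T ]_ (sym (dist-shift x a δ e (proj₁ q')))
                           (sym (dist-shift y b δ (dist-move y δ my) (proj₂ q')))
             (≈-shift δ (sim q∈ q'∈) near)) ,
         (λ inω → move-in-ω y δ my (inω q∈))

    -- a is far from every old point: answer T to the right of the
    -- partner of the largest old point L below a.
    module FarCase (far : ∀ {q} → q ∈ ps → Far T (dist (proj₁ q) a))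
                    (L : Pt × Pt) (largest : LargestBelow a ps L) where

      private
        L∈ = proj₁ largest
        L≺a = proj₁ (proj₂ largest)
        nothing-between = proj₂ (proj₂ largest)

      b : Pt
      b = move (proj₂ L) (+ T) (movable-right (proj₂ L) T)

      dist-b : ∀ w → dist b w ≡ shift (dist (proj₂ L) w) (+ T)
      dist-b = dist-shift (proj₂ L) b (+ T) (dist-move (proj₂ L) (+ T) (movable-right (proj₂ L) T))

      far-right : ∀ u v → u ≺ₖ v → Far T (dist u v) → Big T (dist u v)
      far-right u v u≺v (inj₁ big) = big
      far-right u v u≺v (inj₂ small) = ⊥-elim (big-small-disjoint t (dist u v) (to (≺⇔dist-pos u v) u≺v) small)

      below : ∀ {q} → q ∈ ps → proj₁ q ≺ₖ a → Small T (dist a (proj₁ q)) × Small T (dist b (proj₂ q))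
      below {x , y} q∈ x≺a =
        let qL≥0 = ≈-big z≤n 1≤2T (sim q∈ L∈) (⊀⇒dist-nonneg (proj₁ L) x (nothing-between q∈ x≺a))
        in subst (Small T) (sym (dist-antisym x a)) (big⇒small-neg _ (far-right x a x≺a (far q∈))) ,
           subst (Small T) (sym (trans (dist-b y) (cong (λ e → shift e (+ T)) (dist-antisym y (proj₂ L)))))
             (shift-neg-nonneg (dist y (proj₂ L)) qL≥0)

      above : ∀ {q} → q ∈ ps → a ≺ₖ proj₁ q → Big T (dist a (proj₁ q)) × Big T (dist b (proj₂ q))
      above {x , y} q∈ a≺x =
        let ax = far-right a x a≺x (far-neg (dist a x) (subst (Far T) (dist-antisym a x) (far q∈)))
            Lx = big-add (proj₁ L) a x (far-right (proj₁ L) a L≺a (far L∈)) ax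
        in ax , subst (Big T) (sym (dist-b y))
                  (shift-big (dist (proj₂ L) y) (+ T) (≈-big ≤-refl 1≤2T (sim L∈ q∈) Lx) ℤₚ.≤-refl)

      answer : Answered
      answer = b , good-∷ (m≤n+m T T) a b good new , λ inω → move-in-ω (proj₂ L) (+ T) (movable-right (proj₂ L) T) (inω L∈)
        where
        new : ∀ {q} → q ∈ ps → dist a (proj₁ q) ≈[ T ] dist b (proj₂ q)
        new {q} q∈ with ≺ₖ-trichotomy (proj₁ q) a
        ... | inj₁ x≺a = inj₂ (inj₂ (below q∈ x≺a))
        ... | inj₂ (inj₁ refl) = ⊥-elim (zero-not-far t (subst (Far T) (dist-self (proj₁ q)) (far q∈)))
        ... | inj₂ (inj₂ a≺x) = inj₂ (inj₁ (above q∈ a≺x))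

    answer : Answered
    answer with near-or-far-from T a ps
    ... | inj₁ (q , q∈ , δ , e , near) = near-answer q q∈ δ e near
    ... | inj₂ far with origin-least a
    ...   | inj₂ refl = ⊥-elim (zero-not-far t (subst (Far T) (dist-self origin) (far (proj₁ good))))
    ...   | inj₁ o≺a with largest-below a ps
    ...     | inj₁ none = ⊥-elim (none (proj₁ good) o≺a)
    ...     | inj₂ (L , largest) = FarCase.answer far L largest

  good-swap : ∀ {T ps} → Good T ps → Good T (map swap ps)
  good-swap {T} {ps} (o∈ps , sim) = ∈-map⁺ swap o∈ps , sim'
    where
    sim' : Similar T (map swap ps)
    sim' pm qm with ∈-map⁻ swap pm | ∈-map⁻ swap qm
    ... | (p , p∈ , refl) | (q , q∈ , refl) = ≈-sym (sim p∈ q∈)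

  map-swap² : ∀ {A B : Set} (ps : List (A × B)) → map swap (map swap ps) ≡ ps
  map-swap² [] = refl
  map-swap² (p ∷ ps) = cong (p ∷_) (map-swap² ps)

  -- The scale 2^r used when r rounds remain.
  scale : ℕ → ℕ
  scale zero = 1
  scale (suc r) = scale r ℕ.+ scale r

  1≤scale : ∀ r → 1 ℕ.≤ scale r
  1≤scale zero = s≤s z≤n
  1≤scale (suc r) = ≤-trans (1≤scale r) (m≤m+n (scale r) (scale r))

  -- Positions of ω + ζ against ω, with ω viewed as the first block of ω + ζ.
  embed : Pt × ℕ → Pt × Pt
  embed (x , n) = x , inj₁ n

  ω+ζ≈∞ω : ω+ζ ≈∞ ω
  ω+ζ≈∞ω r = wins-⊆ r (λ ()) (BackAndForth.wins system r start)
    where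
    start : Good (scale r) (map embed ((origin , 0) ∷ []))
    start = here refl , λ { (here refl) (here refl) → inj₁ refl }

    isoAtScale1 : ∀ {ps} → Good 1 (map embed ps) → IsPartialIso ω+ζ ω ps
    isoAtScale1 (_ , sim) {x , n} {y , m} pm qm =
      let (sign , null) = ≈₁⇒same-sign (sim (∈-map⁺ embed pm) (∈-map⁺ embed qm))
      in ⇔.trans (≺⇔dist-pos x y) (⇔.trans sign (⇔.sym (≺⇔dist-pos (inj₁ n) (inj₁ m)))) ,
         ⇔.trans (≡⇔dist-zero x y) (⇔.trans null (⇔.trans (⇔.sym (≡⇔dist-zero (inj₁ n) (inj₁ m)))
           (mk⇔ inj₁-injective (cong inj₁))))

    rightInω : ∀ (ps : List (Pt × ℕ)) {q} → q ∈ map embed ps → InOmega (proj₂ q)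
    rightInω ps q∈ with ∈-map⁻ embed q∈
    ... | (_ , _ , refl) = tt

    forth : ∀ {r} ps → Good (scale (suc r)) (map embed ps) → (a : Pt) →
            Σ ℕ λ n → Good (scale r) (map embed ((a , n) ∷ ps))
    forth {r} ps good a with Answer.answer (scale r) (1≤scale r) (map embed ps) good a
    ... | inj₁ n , good' , _ = n , good'
    ... | inj₂ _ , _ , inω = ⊥-elim (inω (rightInω ps))

    back : ∀ {r} ps → Good (scale (suc r)) (map embed ps) → (n : ℕ) →
           Σ Pt λ a → Good (scale r) (map embed ((a , n) ∷ ps))
    back {r} ps good n =
      let (a , good' , _) = Answer.answer (scale r) (1≤scale r) (map swap (map embed ps)) (good-swap good) (inj₁ n)
      in a , subst (λ qs → Good (scale r) ((a , inj₁ n) ∷ qs)) (map-swap² (map embed ps)) (good-swap good')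

    system : BackAndForth ω+ζ ω
    system = record
      { R = λ r ps → Good (scale r) (map embed ps)
      ; base = isoAtScale1
      ; forth = λ {r} {ps} → forth {r} ps
      ; back = λ {r} {ps} → back {r} ps
      }

open ω+ζ≈ω using (ω; ω+ζ; ω+ζ≈∞ω)
open import Data.Nat using (_≤_; _<_; _+_; _*_; _⊓_)

zeros : (n : ℕ) → Vec ℕ n
zeros n = replicate n 0

Lex-irrefl : ∀ {n} (v : Vec ℕ n) → ¬ Lex v v
Lex-irrefl [] ()
Lex-irrefl (x ∷ v) (inj₁ l) = <-irrefl refl l
Lex-irrefl (x ∷ v) (inj₂ (_ , l)) = Lex-irrefl v l

Lex-trans : ∀ {n} {u v w : Vec ℕ n} → Lex u v → Lex v w → Lex u w
Lex-trans {u = []} {[]} {[]} ()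
Lex-trans {u = x ∷ u} {y ∷ v} {z ∷ w} (inj₁ a) (inj₁ b) = inj₁ (<-trans a b)
Lex-trans {u = x ∷ u} {y ∷ v} {z ∷ w} (inj₁ a) (inj₂ (refl , _)) = inj₁ a
Lex-trans {u = x ∷ u} {y ∷ v} {z ∷ w} (inj₂ (refl , _)) (inj₁ b) = inj₁ b
Lex-trans {u = x ∷ u} {y ∷ v} {z ∷ w} (inj₂ (refl , a)) (inj₂ (refl , b)) = inj₂ (refl , Lex-trans a b)

⊀zeros : ∀ {n} (v : Vec ℕ n) → ¬ Lex v (zeros n)
⊀zeros (x ∷ v) (inj₁ ())
⊀zeros (x ∷ v) (inj₂ (_ , l)) = ⊀zeros v l

zeros-or-above : ∀ {n} (v : Vec ℕ n) → v ≡ zeros n ⊎ Lex (zeros n) v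
zeros-or-above [] = inj₁ refl
zeros-or-above (zero ∷ v) with zeros-or-above v
... | inj₁ e = inj₁ (cong (0 ∷_) e)
... | inj₂ l = inj₂ (inj₂ (refl , l))
zeros-or-above (suc x ∷ v) = inj₂ (inj₁ (s≤s z≤n))

above⇒above-zeros : ∀ {n} {u v : Vec ℕ n} → Lex u v → Lex (zeros n) v
above⇒above-zeros {u = u} {v} l with zeros-or-above v
... | inj₁ refl = ⊥-elim (⊀zeros u l)
... | inj₂ p = p

next : ∀ {p} → Vec ℕ (suc p) → Vec ℕ (suc p)
next (x ∷ []) = suc x ∷ []
next (x ∷ y ∷ ys) = x ∷ next (y ∷ ys)

Lex-next : ∀ {p} (v : Vec ℕ (suc p)) → Lex v (next v)
Lex-next (x ∷ []) = inj₁ ≤-refl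
Lex-next (x ∷ y ∷ ys) = inj₂ (refl , Lex-next (y ∷ ys))

nothing-below-next : ∀ {p} (v c : Vec ℕ (suc p)) → Lex v c → ¬ Lex c (next v)
nothing-below-next (x ∷ []) (c ∷ []) (inj₁ a) (inj₁ b) = <⇒≱ a (≤-pred b)
nothing-below-next (x ∷ y ∷ ys) (c ∷ cs) (inj₁ a) (inj₁ b) = <-asym a b
nothing-below-next (x ∷ y ∷ ys) (c ∷ cs) (inj₁ a) (inj₂ (refl , _)) = <-irrefl refl a
nothing-below-next (x ∷ y ∷ ys) (c ∷ cs) (inj₂ (refl , _)) (inj₁ b) = <-irrefl refl b
nothing-below-next (x ∷ y ∷ ys) (c ∷ cs) (inj₂ (refl , a)) (inj₂ (_ , b)) = nothing-below-next (y ∷ ys) cs a b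

next-∷ʳ : ∀ {p} (u : Vec ℕ p) d → next (u ∷ʳ d) ≡ u ∷ʳ suc d
next-∷ʳ [] d = refl
next-∷ʳ (x ∷ []) d = refl
next-∷ʳ (x ∷ y ∷ u) d = cong (x ∷_) (next-∷ʳ (y ∷ u) d)

-- Vectors ending in 0: the least element and the limit points.
EndsIn0 : ∀ {p} → Vec ℕ (suc p) → Set
EndsIn0 (x ∷ []) = x ≡ 0
EndsIn0 (x ∷ y ∷ ys) = EndsIn0 (y ∷ ys)

endsIn0-∷ʳ0 : ∀ {p} (u : Vec ℕ p) → EndsIn0 (u ∷ʳ 0)
endsIn0-∷ʳ0 [] = refl
endsIn0-∷ʳ0 (x ∷ []) = refl
endsIn0-∷ʳ0 (x ∷ y ∷ u) = endsIn0-∷ʳ0 (y ∷ u)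

next-below-endsIn0 : ∀ {p} (c w : Vec ℕ (suc p)) → Lex c w → EndsIn0 w → Lex (next c) w
next-below-endsIn0 (c ∷ []) (zero ∷ []) (inj₁ ()) _
next-below-endsIn0 (c ∷ []) (zero ∷ []) (inj₂ (_ , ())) _
next-below-endsIn0 (c ∷ d ∷ cs) (w ∷ v ∷ ws) (inj₁ a) _ = inj₁ a
next-below-endsIn0 (c ∷ d ∷ cs) (w ∷ v ∷ ws) (inj₂ (e , l)) lim = inj₂ (e , next-below-endsIn0 (d ∷ cs) (v ∷ ws) l lim)

Lex-∷ʳ⁻ : ∀ {p} (u u' : Vec ℕ p) d d' → Lex (u ∷ʳ d) (u' ∷ʳ d') → Lex u u' ⊎ (u ≡ u' × d < d')
Lex-∷ʳ⁻ [] [] d d' (inj₁ a) = inj₂ (refl , a)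
Lex-∷ʳ⁻ (x ∷ u) (y ∷ u') d d' (inj₁ a) = inj₁ (inj₁ a)
Lex-∷ʳ⁻ (x ∷ u) (y ∷ u') d d' (inj₂ (refl , l)) with Lex-∷ʳ⁻ u u' d d' l
... | inj₁ l' = inj₁ (inj₂ (refl , l'))
... | inj₂ (refl , a) = inj₂ (refl , a)

Lex-∷ʳ : ∀ {p} (u : Vec ℕ p) {d d'} → d < d' → Lex (u ∷ʳ d) (u ∷ʳ d')
Lex-∷ʳ [] a = inj₁ a
Lex-∷ʳ (x ∷ u) a = inj₂ (refl , Lex-∷ʳ u a)

between-siblings : ∀ {p} (u : Vec ℕ p) s w → Lex (u ∷ʳ 0) w → Lex w (u ∷ʳ suc s) →
                   Σ ℕ λ q → w ≡ u ∷ʳ suc q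
between-siblings u s w l₁ l₂ with initLast w
... | u' , d , refl with Lex-∷ʳ⁻ u u' 0 d l₁ | Lex-∷ʳ⁻ u' u d (suc s) l₂
... | inj₁ a | inj₁ c = ⊥-elim (Lex-irrefl _ (Lex-trans a c))
... | inj₁ a | inj₂ (refl , _) = ⊥-elim (Lex-irrefl _ a)
... | inj₂ (refl , s≤s {n = q} _) | _ = q , refl

-- v lies in the initial copy of ω: all digits but the last vanish.
inFirstω : ∀ {p} → Vec ℕ (suc p) → Bool
inFirstω (x ∷ []) = true
inFirstω (zero ∷ y ∷ ys) = inFirstω (y ∷ ys)
inFirstω (suc x ∷ y ∷ ys) = false

lastDigit : ∀ {p} → Vec ℕ (suc p) → ℕ
lastDigit (x ∷ []) = x
lastDigit (x ∷ y ∷ ys) = lastDigit (y ∷ ys)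

finite : ∀ {p} → ℕ → Vec ℕ (suc p)
finite {zero} d = d ∷ []
finite {suc p} d = 0 ∷ finite {p} d

finite-inFirstω : ∀ {p} d → inFirstω (finite {p} d) ≡ true
finite-inFirstω {zero} d = refl
finite-inFirstω {suc zero} d = refl
finite-inFirstω {suc (suc p)} d = finite-inFirstω {suc p} d

lastDigit-finite : ∀ {p} d → lastDigit (finite {p} d) ≡ d
lastDigit-finite {zero} d = refl
lastDigit-finite {suc zero} d = refl
lastDigit-finite {suc (suc p)} d = lastDigit-finite {suc p} d

finite-lastDigit : ∀ {p} (v : Vec ℕ (suc p)) → inFirstω v ≡ true → finite (lastDigit v) ≡ v
finite-lastDigit (x ∷ []) _ = refl
finite-lastDigit (zero ∷ y ∷ ys) e = cong (0 ∷_) (finite-lastDigit (y ∷ ys) e)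

finite-reflects : ∀ {p} x y → Lex (finite {p} x) (finite {p} y) → x < y
finite-reflects {zero} x y (inj₁ l) = l
finite-reflects {suc p} x y (inj₂ (_ , l)) = finite-reflects {p} x y l

finite-mono : ∀ {p} x y → x < y → Lex (finite {p} x) (finite {p} y)
finite-mono {zero} x y l = inj₁ l
finite-mono {suc p} x y l = inj₂ (refl , finite-mono {p} x y l)

inFirstω-down : ∀ {p} (a b : Vec ℕ (suc p)) → inFirstω b ≡ true → Lex a b → inFirstω a ≡ true
inFirstω-down (x ∷ []) b _ _ = refl
inFirstω-down (zero ∷ a₁ ∷ as) (zero ∷ b₁ ∷ bs) e (inj₂ (_ , l)) = inFirstω-down (a₁ ∷ as) (b₁ ∷ bs) e l

inFirstω-below : ∀ {p} (a b : Vec ℕ (suc p)) → inFirstω a ≡ true → inFirstω b ≡ false → Lex a b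
inFirstω-below (zero ∷ a₁ ∷ as) (suc b₀ ∷ b₁ ∷ bs) e e' = inj₁ (s≤s z≤n)
inFirstω-below (zero ∷ a₁ ∷ as) (zero ∷ b₁ ∷ bs) e e' = inj₂ (refl , inFirstω-below (a₁ ∷ as) (b₁ ∷ bs) e e')

Rest : ℕ → LinOrd
Rest p = record { Car = Σ (Vec ℕ (suc p)) (λ v → T (not (inFirstω v)))
                ; _≺_ = λ a b → Lex (proj₁ a) (proj₁ b) }

module SplitFirstω (p : ℕ) where

  data View (v : Vec ℕ (suc p)) : Set where
    first : inFirstω {p} v ≡ true → View v
    rest : T (not (inFirstω {p} v)) → View v

  view : ∀ v → View v
  view v with inFirstω {p} v in e
  ... | true = first e
  ... | false = rest (subst (λ b → T (not b)) (sym e) tt)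

  rest⇒false : ∀ v → T (not (inFirstω {p} v)) → inFirstω {p} v ≡ false
  rest⇒false v t with inFirstω {p} v
  ... | false = refl

  split′ : (v : Vec ℕ (suc p)) → View v → ℕ ⊎ Car (Rest p)
  split′ v (first _) = inj₁ (lastDigit v)
  split′ v (rest t) = inj₂ (v , t)

  split : Vec ℕ (suc p) → ℕ ⊎ Car (Rest p)
  split v = split′ v (view v)

  split-first : ∀ v → inFirstω {p} v ≡ true → split v ≡ inj₁ (lastDigit v)
  split-first v e with view v
  ... | first _ = refl
  ... | rest t = ⊥-elim (subst (λ b → T (not b)) e t)

  split-rest : ∀ v (t : T (not (inFirstω {p} v))) → split v ≡ inj₂ (v , t)
  split-rest v t with view v
  ... | first e = ⊥-elim (subst (λ b → T (not b)) e t)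
  ... | rest t' = cong (λ z → inj₂ (v , z)) (T-irrelevant t' t)

  join : ℕ ⊎ Car (Rest p) → Vec ℕ (suc p)
  join (inj₁ d) = finite d
  join (inj₂ (v , _)) = v

  _≺ₛ_ : ℕ ⊎ Car (Rest p) → ℕ ⊎ Car (Rest p) → Set
  _≺ₛ_ = _≺_ (ω ⊕ Rest p)

  split-mono : ∀ a b (va : View a) (vb : View b) → Lex a b → split′ a va ≺ₛ split′ b vb
  split-mono a b (first ea) (first eb) l =
    finite-reflects {p} _ _ (subst₂ Lex (sym (finite-lastDigit {p} a ea)) (sym (finite-lastDigit {p} b eb)) l)
  split-mono a b (first ea) (rest tb) l = tt
  split-mono a b (rest ta) (first eb) l with trans (sym (rest⇒false a ta)) (inFirstω-down {p} a b eb l)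
  ... | ()
  split-mono a b (rest ta) (rest tb) l = l

  split-reflects : ∀ a b (va : View a) (vb : View b) → split′ a va ≺ₛ split′ b vb → Lex a b
  split-reflects a b (first ea) (first eb) l =
    subst₂ Lex (finite-lastDigit {p} a ea) (finite-lastDigit {p} b eb) (finite-mono {p} _ _ l)
  split-reflects a b (first ea) (rest tb) l = inFirstω-below {p} a b ea (rest⇒false b tb)
  split-reflects a b (rest ta) (rest tb) l = l

  join-split : ∀ v (vv : View v) → join (split′ v vv) ≡ v
  join-split v (first e) = finite-lastDigit {p} v e
  join-split v (rest t) = refl

  iso : ω^ (suc p) ≅ (ω ⊕ Rest p)
  iso = record
    { f = split ; g = join
    ; f∘g = λ { (inj₁ d) → trans (split-first (finite d) (finite-inFirstω {p} d)) (cong inj₁ (lastDigit-finite {p} d))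
              ; (inj₂ (v , t)) → split-rest v t }
    ; g∘f = λ v → join-split v (view v)
    ; f-mono = λ a b → split-mono a b (view a) (view b)
    ; f-reflects = λ a b → split-reflects a b (view a) (view b) }

-- ω + ω* + ω is ω + ζ: the second and third blocks together form ζ.
ω+ω*+ω≅ω+ζ : ((ω^ 1 ⊕ ω*^ 1) ⊕ ω) ≅ ω+ζ
ω+ω*+ω≅ω+ζ = record { f = f ; g = g ; f∘g = f∘g ; g∘f = g∘f ; f-mono = f-mono ; f-reflects = f-reflects }
  where
  open import Data.Integer using (+_; -[1+_]; +<+; -<+; -<-)
  A = (ω^ 1 ⊕ ω*^ 1) ⊕ ω

  f : Car A → Car ω+ζ
  f (inj₁ (inj₁ (i ∷ []))) = inj₁ i
  f (inj₁ (inj₂ (i ∷ []))) = inj₂ -[1+ i ]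
  f (inj₂ j) = inj₂ (+ j)

  g : Car ω+ζ → Car A
  g (inj₁ i) = inj₁ (inj₁ (i ∷ []))
  g (inj₂ (+ j)) = inj₂ j
  g (inj₂ -[1+ i ]) = inj₁ (inj₂ (i ∷ []))

  f∘g : ∀ y → f (g y) ≡ y
  f∘g (inj₁ i) = refl
  f∘g (inj₂ (+ j)) = refl
  f∘g (inj₂ -[1+ i ]) = refl

  g∘f : ∀ x → g (f x) ≡ x
  g∘f (inj₁ (inj₁ (i ∷ []))) = refl
  g∘f (inj₁ (inj₂ (i ∷ []))) = refl
  g∘f (inj₂ j) = refl

  f-mono : ∀ a b → _≺_ A a b → _≺_ ω+ζ (f a) (f b)
  f-mono (inj₁ (inj₁ (i ∷ []))) (inj₁ (inj₁ (j ∷ []))) (inj₁ l) = l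
  f-mono (inj₁ (inj₁ (i ∷ []))) (inj₁ (inj₂ (j ∷ []))) l = tt
  f-mono (inj₁ (inj₁ (i ∷ []))) (inj₂ j) l = tt
  f-mono (inj₁ (inj₂ (i ∷ []))) (inj₁ (inj₂ (j ∷ []))) (inj₁ l) = -<- l
  f-mono (inj₁ (inj₂ (i ∷ []))) (inj₂ j) l = -<+
  f-mono (inj₂ i) (inj₂ j) l = +<+ l

  f-reflects : ∀ a b → _≺_ ω+ζ (f a) (f b) → _≺_ A a b
  f-reflects (inj₁ (inj₁ (i ∷ []))) (inj₁ (inj₁ (j ∷ []))) l = inj₁ l
  f-reflects (inj₁ (inj₁ (i ∷ []))) (inj₁ (inj₂ (j ∷ []))) l = tt
  f-reflects (inj₁ (inj₁ (i ∷ []))) (inj₂ j) l = tt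
  f-reflects (inj₁ (inj₂ (i ∷ []))) (inj₁ (inj₂ (j ∷ []))) (-<- l) = inj₁ l
  f-reflects (inj₁ (inj₂ (i ∷ []))) (inj₂ j) l = tt
  f-reflects (inj₁ (inj₂ (i ∷ []))) (inj₁ (inj₁ (j ∷ []))) ()
  f-reflects (inj₂ i) (inj₁ (inj₁ (j ∷ []))) ()
  f-reflects (inj₂ i) (inj₁ (inj₂ (j ∷ []))) ()
  f-reflects (inj₂ i) (inj₂ j) (+<+ l) = l

⊕-assoc : (U C D : LinOrd) → (U ⊕ (C ⊕ D)) ≅ ((U ⊕ C) ⊕ D)
⊕-assoc U C D = record { f = f ; g = g ; f∘g = f∘g ; g∘f = g∘f ; f-mono = f-mono ; f-reflects = f-reflects }
  where
  f : Car (U ⊕ (C ⊕ D)) → Car ((U ⊕ C) ⊕ D)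
  f (inj₁ u) = inj₁ (inj₁ u)
  f (inj₂ (inj₁ c)) = inj₁ (inj₂ c)
  f (inj₂ (inj₂ d)) = inj₂ d

  g : Car ((U ⊕ C) ⊕ D) → Car (U ⊕ (C ⊕ D))
  g (inj₁ (inj₁ u)) = inj₁ u
  g (inj₁ (inj₂ c)) = inj₂ (inj₁ c)
  g (inj₂ d) = inj₂ (inj₂ d)

  f∘g : ∀ y → f (g y) ≡ y
  f∘g (inj₁ (inj₁ u)) = refl
  f∘g (inj₁ (inj₂ c)) = refl
  f∘g (inj₂ d) = refl

  g∘f : ∀ x → g (f x) ≡ x
  g∘f (inj₁ u) = refl
  g∘f (inj₂ (inj₁ c)) = refl
  g∘f (inj₂ (inj₂ d)) = refl

  f-mono : ∀ a b → _≺_ (U ⊕ (C ⊕ D)) a b → _≺_ ((U ⊕ C) ⊕ D) (f a) (f b)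
  f-mono (inj₁ u) (inj₁ u') l = l
  f-mono (inj₁ u) (inj₂ (inj₁ c)) l = tt
  f-mono (inj₁ u) (inj₂ (inj₂ d)) l = tt
  f-mono (inj₂ (inj₁ c)) (inj₂ (inj₁ c')) l = l
  f-mono (inj₂ (inj₁ c)) (inj₂ (inj₂ d)) l = tt
  f-mono (inj₂ (inj₂ d)) (inj₂ (inj₂ d')) l = l

  f-reflects : ∀ a b → _≺_ ((U ⊕ C) ⊕ D) (f a) (f b) → _≺_ (U ⊕ (C ⊕ D)) a b
  f-reflects (inj₁ u) (inj₁ u') l = l
  f-reflects (inj₁ u) (inj₂ (inj₁ c)) l = tt
  f-reflects (inj₁ u) (inj₂ (inj₂ d)) l = tt
  f-reflects (inj₂ (inj₁ c)) (inj₂ (inj₁ c')) l = l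
  f-reflects (inj₂ (inj₁ c)) (inj₂ (inj₂ d)) l = tt
  f-reflects (inj₂ (inj₂ d)) (inj₂ (inj₂ d')) l = l

ω+ω*+ω^m≈∞ω^m : ∀ p → (ω^ 1 ⊕ ω*^ 1 ⊕ ω^ (suc p)) ≈∞ ω^ (suc p)
ω+ω*+ω^m≈∞ω^m p =
  ≈∞-trans (≈∞-⊕ (≅⇒≈∞ ≅-refl) (≅⇒≈∞ split)) (
  ≈∞-trans (≅⇒≈∞ (⊕-assoc (ω^ 1 ⊕ ω*^ 1) ω (Rest p))) (
  ≈∞-trans (≈∞-⊕ (≈∞-trans (≅⇒≈∞ ω+ω*+ω≅ω+ζ) ω+ζ≈∞ω) (≅⇒≈∞ ≅-refl))
           (≅⇒≈∞ (≅-sym split))))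
  where split = SplitFirstω.iso p

module _ {X Y : LinOrd} where

  -- A position from which II can still win is a partial isomorphism.
  -- (Unwinding needs a move to play, hence a point x₀ of X.)
  winning⇒iso : Car X → ∀ n {r} {xs : Vec (Car X) r} {ys : Vec (Car Y) r} →
                IIWins X Y n xs ys → PartialIso X Y xs ys
  winning⇒iso x₀ zero w = w
  winning⇒iso x₀ (suc n) (forth , _) i j = winning⇒iso x₀ n (proj₂ (forth x₀)) (fs i) (fs j)

  IIWins-swap : ∀ n {r} {xs : Vec (Car X) r} {ys : Vec (Car Y) r} →
                IIWins X Y n xs ys → IIWins Y X n ys xs
  IIWins-swap zero w i j = ⇔.sym (proj₁ (w i j)) , ⇔.sym (proj₂ (w i j))
  IIWins-swap (suc n) (forth , back) =
    (λ b → let (a , w) = back b in a , IIWins-swap n w) ,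
    (λ a → let (b , w) = forth a in b , IIWins-swap n w)

  gap : (x₀ : Car X) → ∀ n {r} (xs : Vec (Car X) r) (ys : Vec (Car Y) r) (i j : Fin r) →
        (∀ z → _≺_ X (lookup xs i) z → ¬ _≺_ X z (lookup xs j)) →
        (z' : Car Y) → _≺_ Y (lookup ys i) z' → _≺_ Y z' (lookup ys j) →
        ¬ IIWins X Y (suc n) xs ys
  gap x₀ n xs ys i j adjacent z' i<z' z'<j (_ , back) =
    let (z , w) = back z'
        iso = winning⇒iso x₀ n w
    in adjacent z (from (proj₁ (iso (fs i) fz)) i<z') (from (proj₁ (iso fz (fs j))) z'<j)

-- Limit points of rank j: Lim X (1 + j) a says that points of rank j lie
-- arbitrarily close below a.  In ω^n these are 0 and the multiples of ω^j.
Lim : (X : LinOrd) → ℕ → Car X → Set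
Lim X zero a = ⊤
Lim X (suc j) a = ∀ z → _≺_ X z a → Σ (Car X) λ w → _≺_ X z w × _≺_ X w a × Lim X j w

Lim-pred : ∀ X j a → Lim X (suc j) a → Lim X j a
Lim-pred X zero a h = tt
Lim-pred X (suc j) a h z z<a =
  let (w , z<w , w<a , lim) = h z z<a in w , z<w , w<a , Lim-pred X j w lim

double : ℕ → ℕ
double zero = zero
double (suc j) = suc (suc (double j))

-- Rank j is preserved by II's winning strategies of length 2j: each
-- point approaching one side is answered by a point approaching the other.
Lim-transfer : ∀ {X Y} (x₀ : Car X) j {r} {xs : Vec (Car X) r} {ys : Vec (Car Y) r} a b →
               IIWins X Y (double j) (a ∷ xs) (b ∷ ys) → Lim Y j b → Lim X j a
Lim-transfer x₀ zero a b w lim = tt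
Lim-transfer {X} {Y} x₀ (suc j) a b (forth , _) lim z z<a =
  let (z' , w₁) = forth z
      z'<b = to (proj₁ ((winning⇒iso x₀ _ w₁) fz (fs fz))) z<a
      (v' , z'<v' , v'<b , lim') = lim z' z'<b
      (v , w₂) = proj₂ w₁ v'
      iso = winning⇒iso x₀ _ w₂
  in v , from (proj₁ (iso (fs fz) fz)) z'<v' , from (proj₁ (iso fz (fs (fs fz)))) v'<b , Lim-transfer x₀ j v v' w₂ lim'

-- If every point of Y lies below a point of rank j, but nothing above a
-- in X has rank j, player I wins in 2j + 2 moves: play a, then a point of
-- rank j above II's answer, and let the rank be transferred.
rank-separation : ∀ {X Y} j (a : Car X) →
  (∀ b → Σ (Car Y) λ b' → _≺_ Y b b' × Lim Y j b') →
  (∀ a' → _≺_ X a a' → ¬ Lim X j a') →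
  ¬ IIWins X Y (suc (suc (double j))) [] []
rank-separation {X} {Y} j a upward nothing-above (forth , _) =
  let (b , w₁) = forth a
      (b' , b<b' , lim) = upward b
      (a' , w₂) = proj₂ w₁ b'
  in nothing-above a' (from (proj₁ ((winning⇒iso a _ w₂) (fs fz) fz)) b<b') (Lim-transfer a j a' b' w₂ lim)

Lim-⊕ʳ : ∀ A B j y → Lim (A ⊕ B) j (inj₂ y) → Lim B j y
Lim-⊕ʳ A B zero y h = tt
Lim-⊕ʳ A B (suc j) y h z z<y with h (inj₂ z) z<y
... | inj₂ w , z<w , w<y , lim = w , z<w , w<y , Lim-⊕ʳ A B j w lim

Lim-⊕ʳ⁻ : ∀ A B j y₀ y → _≺_ B y₀ y → Lim B j y → Lim (A ⊕ B) j (inj₂ y)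
Lim-⊕ʳ⁻ A B zero y₀ y _ h = tt
Lim-⊕ʳ⁻ A B (suc j) y₀ y y₀<y h (inj₁ a) _ =
  let (w , y₀<w , w<y , lim) = h y₀ y₀<y in inj₂ w , tt , w<y , Lim-⊕ʳ⁻ A B j y₀ w y₀<w lim
Lim-⊕ʳ⁻ A B (suc j) y₀ y y₀<y h (inj₂ z) z<y =
  let (w , z<w , w<y , lim) = h z z<y in inj₂ w , z<w , w<y , Lim-⊕ʳ⁻ A B j z w z<w lim

Lim-∷ : ∀ {p} j c (us : Vec ℕ p) → Lex (zeros p) us → Lim (ω^ p) j us → Lim (ω^ (suc p)) j (c ∷ us)
Lim-∷ zero c us _ _ = tt
Lim-∷ {p} (suc j) c us pos h (z₀ ∷ zs) (inj₁ a) =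
  let (w , 0<w , w<us , lim) = h (zeros p) pos in (c ∷ w) , inj₁ a , inj₂ (refl , w<us) , Lim-∷ j c w 0<w lim
Lim-∷ {p} (suc j) c us pos h (z₀ ∷ zs) (inj₂ (e , l)) =
  let (w , zs<w , w<us , lim) = h zs l
  in (c ∷ w) , inj₂ (e , zs<w) , inj₂ (refl , w<us) , Lim-∷ j c w (above⇒above-zeros zs<w) lim

Lim-∷⁻ : ∀ {p} j c (us : Vec ℕ p) → Lim (ω^ (suc p)) j (c ∷ us) → Lim (ω^ p) j us
Lim-∷⁻ zero c us _ = tt
Lim-∷⁻ (suc j) c us h z z<us with h (c ∷ z) (inj₂ (refl , z<us))
... | (w₀ ∷ ws) , inj₁ a , inj₁ b , _ = ⊥-elim (<-asym a b)
... | (w₀ ∷ ws) , inj₁ a , inj₂ (refl , _) , _ = ⊥-elim (<-irrefl refl a)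
... | (w₀ ∷ ws) , inj₂ (refl , _) , inj₁ b , _ = ⊥-elim (<-irrefl refl b)
... | (w₀ ∷ ws) , inj₂ (refl , z<ws) , inj₂ (_ , ws<us) , lim = ws , z<ws , ws<us , Lim-∷⁻ j w₀ ws lim

no-rank-n : ∀ n (w : Vec ℕ n) → Lex (zeros n) w → ¬ Lim (ω^ n) n w
no-rank-n (suc p) (x ∷ xs) pos lim with zeros-or-above xs
... | inj₂ xs-pos = no-rank-n p xs xs-pos (Lim-pred (ω^ p) p xs (Lim-∷⁻ (suc p) x xs lim))
no-rank-n (suc p) (zero ∷ xs) pos lim | inj₁ refl = Lex-irrefl _ pos
no-rank-n (suc p) (suc x ∷ xs) pos lim | inj₁ refl with lim (x ∷ zeros p) (inj₁ ≤-refl)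
... | (c ∷ us) , _ , inj₂ (_ , us<0) , _ = ⊥-elim (⊀zeros us us<0)
... | (c ∷ us) , inj₁ a , inj₁ b , _ = <⇒≱ a (≤-pred b)
... | (c ∷ us) , inj₂ (refl , us-pos) , inj₁ b , lim' = no-rank-n p us us-pos (Lim-∷⁻ p x us lim')

-- For j < n, points of rank j are unbounded in ω^n: (1 + x, 0, …, 0) has rank n - 1.
mutual
  rank-above : ∀ n j → j < n → (u : Vec ℕ n) → Σ (Vec ℕ n) λ v → Lex u v × Lim (ω^ n) j v
  rank-above (suc p) j (s≤s j≤p) (x ∷ xs) = (suc x ∷ zeros p) , inj₁ ≤-refl , rank-leading p (suc x) j j≤p

  rank-leading : ∀ p x j → j ≤ p → Lim (ω^ (suc p)) j (x ∷ zeros p)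
  rank-leading p x zero _ = tt
  rank-leading p x (suc j) j<p (c ∷ zs) (inj₂ (_ , zs<0)) = ⊥-elim (⊀zeros zs zs<0)
  rank-leading p x (suc j) j<p (c ∷ zs) (inj₁ c<x) =
    let (w , zs<w , lim) = rank-above p j j<p zs
    in (c ∷ w) , inj₂ (refl , zs<w) , inj₁ c<x , Lim-∷ j c w (above⇒above-zeros zs<w) lim

LHS : ℕ → ℕ → ℕ → LinOrd
LHS k l m = ω^ k ⊕ ω*^ l ⊕ ω^ m

-- m < n: above the start of its last block, LHS has no point of rank m,
-- while points of rank m are unbounded in ω^n.
separate-m<n : ∀ k l m n → m < n → ¬ IIWins (LHS k l m) (ω^ n) (suc (suc (double m))) [] []
separate-m<n k l m n m<n = rank-separation m (inj₂ (zeros m)) (rank-above n m m<n) nothing-above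
  where
  nothing-above : ∀ a → _≺_ (LHS k l m) (inj₂ (zeros m)) a → ¬ Lim (LHS k l m) m a
  nothing-above (inj₂ w) 0<w lim = no-rank-n m w 0<w (Lim-⊕ʳ _ _ m w lim)

-- n < m: symmetrically, points of rank n are unbounded in LHS but not in ω^n.
separate-n<m : ∀ k l m n → n < m → ¬ IIWins (LHS k l m) (ω^ n) (suc (suc (double n))) [] []
separate-n<m k l m n n<m w =
  rank-separation n (zeros n) upward (no-rank-n n) (IIWins-swap (suc (suc (double n))) w)
  where
  upward : ∀ b → Σ (Car (LHS k l m)) λ b' → _≺_ (LHS k l m) b b' × Lim (LHS k l m) n b'
  upward (inj₂ u) = let (v , u<v , lim) = rank-above m n n<m u in inj₂ v , u<v , Lim-⊕ʳ⁻ _ _ n u v u<v lim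
  upward (inj₁ _) = let (v , 0<v , lim) = rank-above m n n<m (zeros m) in
    inj₂ v , tt , Lim-⊕ʳ⁻ _ _ n (zeros m) v 0<v lim

double≡2* : ∀ j → double j ≡ 2 * j
double≡2* zero = refl
double≡2* (suc j) = trans (cong (2 +_) (double≡2* j)) (sym (*-suc 2 j))

rounds-min : ∀ m n j → m ⊓ n ≡ j → 2 * (m ⊓ n) + 2 ≡ suc (suc (double j))
rounds-min m n j refl = trans (+-comm (2 * (m ⊓ n)) 2) (cong (2 +_) (sym (double≡2* (m ⊓ n))))

different-last-exponent : ∀ k l m n → m ≢ n → ¬ EFEquiv (2 * (m ⊓ n) + 2) (LHS k l m) (ω^ n)
different-last-exponent k l m n m≢n w with <-cmp m n
... | tri< m<n _ _ = separate-m<n k l m n m<n (subst (λ r → EFEquiv r (LHS k l m) (ω^ n))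
                       (rounds-min m n m (m≤n⇒m⊓n≡m (<⇒≤ m<n))) w)
... | tri≈ _ m≡n _ = m≢n m≡n
... | tri> _ _ n<m = separate-n<m k l m n n<m (subst (λ r → EFEquiv r (LHS k l m) (ω^ n))
                       (rounds-min m n n (m≥n⇒m⊓n≡n (<⇒≤ n<m))) w)

-- If some point a of X has no immediate successor while every point of Y
-- has one, player I wins in 3 moves: play a, then the successor of II's
-- answer, then a point between a and II's second answer.
successor-game : ∀ {X Y} (a : Car X) → (∀ y → _≺_ X a y → Σ (Car X) λ z → _≺_ X a z × _≺_ X z y) →
  (succ : Car Y → Car Y) → (∀ b → _≺_ Y b (succ b)) → (∀ b c → _≺_ Y b c → ¬ _≺_ Y c (succ b)) →
  ¬ EFEquiv 3 X Y
successor-game {X} {Y} a dense succ b<succ adjacent (forth , _) =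
  let (b , w₁) = forth a
      (y , w₂) = proj₂ w₁ (succ b)
      a<y = from (proj₁ (winning⇒iso {X} {Y} a 1 w₂ (fs fz) fz)) (b<succ b)
      (z , a<z , z<y) = dense y a<y
  in gap {Y} {X} b 0 (succ b ∷ b ∷ []) (y ∷ a ∷ []) (fs fz) fz (adjacent b) z a<z z<y (IIWins-swap {X} {Y} 1 w₂)

-- In (ω*)^(2+q) the point (1, 0, …, 0) has no immediate successor: the
-- points above it form a copy of ω* with no least element.
no-successor-in-ω*^2 : ∀ k m q (y : Car (LHS k (suc (suc q)) m)) →
  let a = inj₁ (inj₂ (1 ∷ zeros (suc q))) in
  _≺_ (LHS k (suc (suc q)) m) a y → Σ (Car (LHS k (suc (suc q)) m)) λ z →
    _≺_ (LHS k (suc (suc q)) m) a z × _≺_ (LHS k (suc (suc q)) m) z y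
no-successor-in-ω*^2 k m q (inj₁ (inj₂ (zero ∷ ds))) _ = inj₁ (inj₂ (0 ∷ next ds)) , inj₁ (s≤s z≤n) , inj₂ (refl , Lex-next ds)
no-successor-in-ω*^2 k m q (inj₁ (inj₂ (suc d ∷ ds))) (inj₁ (s≤s ()))
no-successor-in-ω*^2 k m q (inj₁ (inj₂ (d ∷ ds))) (inj₂ (_ , ds<0)) = ⊥-elim (⊀zeros ds ds<0)
no-successor-in-ω*^2 k m q (inj₂ v) _ = inj₁ (inj₂ (zeros (suc (suc q)))) , inj₁ (s≤s z≤n) , tt

ω*-exponent-above-1 : ∀ k q m n → ¬ EFEquiv 3 (LHS k (suc (suc q)) m) (ω^ (suc n))
ω*-exponent-above-1 k q m n =
  successor-game (inj₁ (inj₂ (1 ∷ zeros (suc q)))) (no-successor-in-ω*^2 k m q) next Lex-next nothing-below-next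

-- The relevant features:
-- in Y = ω^(1+n) every point u ∷ʳ (1+q) has an immediate predecessor and
-- points u ∷ʳ 0 have none; in X the points of the ω* block all have
-- immediate predecessors, and (as k ≥ 2) the ω^k block has points without
-- one above any of its points.
module FiveMoves (k m n : ℕ) where

  X : LinOrd
  X = LHS (suc (suc k)) 1 m

  Y : LinOrd
  Y = ω^ (suc n)

  -- The ω* block, counted downwards from its top point star 0.
  star : ℕ → Car X
  star d = inj₁ (inj₂ (d ∷ []))

  star-adjacent : ∀ d x → _≺_ X (star (suc d)) x → ¬ _≺_ X x (star d)
  star-adjacent d (inj₁ (inj₂ (e ∷ []))) (inj₁ d<e) (inj₁ e<1+d) = <⇒≱ e<1+d (≤-pred d<e)

  sibling-adjacent : ∀ (u : Vec ℕ n) q z → Lex (u ∷ʳ q) z → ¬ Lex z (u ∷ʳ suc q)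
  sibling-adjacent u q z l l' = nothing-below-next (u ∷ʳ q) z l (subst (Lex z) (sym (next-∷ʳ u q)) l')

  endsIn0-zeros : ∀ p → EndsIn0 (zeros (suc p))
  endsIn0-zeros zero = refl
  endsIn0-zeros (suc p) = endsIn0-zeros p

  -- A point of the ω* block cannot be matched with a point u ∷ʳ 0: I plays
  -- the predecessor in X, then a point just above II's answer in Y.
  star-vs-endsIn0 : ∀ d u {r n'} (xs : Vec (Car X) r) ys →
                    ¬ IIWins X Y (suc (suc n')) (star d ∷ xs) ((u ∷ʳ 0) ∷ ys)
  star-vs-endsIn0 d u {n' = n'} xs ys (forth , _) =
    let (e , w) = forth (star (suc d))
        e<u0 = to (proj₁ (winning⇒iso {X} {Y} (star 0) (suc n') w fz (fs fz))) (inj₁ ≤-refl)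
    in gap (star 0) n' (star (suc d) ∷ star d ∷ xs) (e ∷ (u ∷ʳ 0) ∷ ys) fz (fs fz) (star-adjacent d)
         (next e) (Lex-next e) (next-below-endsIn0 e (u ∷ʳ 0) e<u0 (endsIn0-∷ʳ0 u)) w

  -- A point of the ω^k block ending in 0 cannot be matched with a point
  -- u ∷ʳ (1+q): I plays the predecessor u ∷ʳ q in Y, then a point just
  -- above II's answer in X.
  endsIn0-vs-successor : ∀ vp → EndsIn0 vp → ∀ u w' → Σ ℕ (λ q → w' ≡ u ∷ʳ suc q) →
                         ∀ {r n'} (xs : Vec (Car X) r) ys →
                         ¬ IIWins X Y (suc (suc n')) (inj₁ (inj₁ vp) ∷ xs) (w' ∷ ys)
  endsIn0-vs-successor vp lim u _ (q , refl) {n' = n'} xs ys (_ , back) =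
    let (p , w) = back (u ∷ʳ q)
    in finish p (from (proj₁ (winning⇒iso {X} {Y} (star 0) (suc n') w fz (fs fz))) (Lex-∷ʳ u ≤-refl)) w
    where
    finish : ∀ p → _≺_ X p (inj₁ (inj₁ vp)) →
             ¬ IIWins X Y (suc n') (p ∷ inj₁ (inj₁ vp) ∷ xs) ((u ∷ʳ q) ∷ (u ∷ʳ suc q) ∷ ys)
    finish (inj₁ (inj₁ v)) v<vp w =
      gap {Y} {X} (u ∷ʳ q) n' ((u ∷ʳ q) ∷ (u ∷ʳ suc q) ∷ ys) (inj₁ (inj₁ v) ∷ inj₁ (inj₁ vp) ∷ xs)
        fz (fs fz) (sibling-adjacent u q) (inj₁ (inj₁ (next v))) (Lex-next v)
        (next-below-endsIn0 v vp v<vp lim) (IIWins-swap {X} {Y} (suc n') w)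

  -- Position after I played star 0 and then u ∷ʳ 0 below II's answer u ∷ʳ (1+s).
  below-top : ∀ u s x → _≺_ X x (star 0) → ∀ n' →
              ¬ IIWins X Y (suc (suc (suc n'))) (x ∷ star 0 ∷ []) ((u ∷ʳ 0) ∷ (u ∷ʳ suc s) ∷ [])
  below-top u s (inj₁ (inj₂ (d ∷ []))) _ n' = star-vs-endsIn0 d u _ _
  below-top u s (inj₁ (inj₁ (v₀ ∷ vs))) _ n' (forth , _) =
    let vp = suc v₀ ∷ zeros (suc k)
        (w' , w) = forth (inj₁ (inj₁ vp))
        iso = winning⇒iso {X} {Y} (star 0) (suc (suc n')) w
        u0<w' = to (proj₁ (iso (fs fz) fz)) (inj₁ ≤-refl)
        w'<b = to (proj₁ (iso fz (fs (fs fz)))) tt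
    in endsIn0-vs-successor vp (endsIn0-zeros k) u w' (between-siblings u s w' u0<w' w'<b) _ _ w

  five-moves : ∀ n' → ¬ EFEquiv (5 + n') X Y
  five-moves n' (forth , _) with forth (star 0)
  ... | b , w with initLast b
  ...   | u , zero , refl = star-vs-endsIn0 0 u [] [] w
  ...   | u , suc s , refl =
    let (x , w') = proj₂ w (u ∷ʳ 0)
        x<top = from (proj₁ (winning⇒iso {X} {Y} (star 0) (3 + n') w' fz (fs fz))) (Lex-∷ʳ u (s≤s z≤n))
    in below-top u s x x<top n' w'

necessary : ∀ k l m n → ElemEquiv (LHS (suc k) (suc l) (suc m)) (ω^ (suc n)) →
            suc k ≡ 1 × suc l ≡ 1 × suc m ≡ suc n
necessary k l m n E with suc m ≟ suc n
... | no m≢n = ⊥-elim (different-last-exponent (suc k) (suc l) (suc m) (suc n) m≢n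
                 (E (2 * (suc m ⊓ suc n) + 2) (≤-trans (s≤s z≤n) (m≤n+m 2 (2 * (suc m ⊓ suc n))))))
necessary k (suc q) m n E | yes _ = ⊥-elim (ω*-exponent-above-1 (suc k) q (suc m) n (E 3 (s≤s z≤n)))
necessary (suc k') zero m n E | yes _ = ⊥-elim (FiveMoves.five-moves k' (suc m) n 1 (E 6 (s≤s z≤n)))
necessary zero zero m n E | yes m≡n = refl , refl , m≡n

lemma4p4 : (k l m n : ℕ) → 1 ≤ k → 1 ≤ l → 1 ≤ m → 1 ≤ n →
    (ElemEquiv (ω^ k ⊕ ω*^ l ⊕ ω^ m) (ω^ n) ⇔ (k ≡ 1 × l ≡ 1 × m ≡ n))
    × (m ≢ n → ¬ EFEquiv (2 * (m ⊓ n) + 2) (ω^ k ⊕ ω*^ l ⊕ ω^ m) (ω^ n))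
    × (1 < l → ¬ EFEquiv 3 (ω^ k ⊕ ω*^ l ⊕ ω^ m) (ω^ n))
    × (l ≡ 1 → m ≡ n → 1 < k → ¬ EFEquiv 6 (ω^ k ⊕ ω*^ l ⊕ ω^ m) (ω^ n))
lemma4p4 (suc k) (suc l) (suc m) (suc n) _ _ _ _ =
  mk⇔ (necessary k l m n) sufficient , different-last-exponent _ _ _ _ , l>1 , k>1
  where
  sufficient : suc k ≡ 1 × suc l ≡ 1 × suc m ≡ suc n → ElemEquiv (LHS (suc k) (suc l) (suc m)) (ω^ (suc n))
  sufficient (refl , refl , refl) r _ = toIIWins r [] [] (ω+ω*+ω^m≈∞ω^m m r)

  l>1 : 1 < suc l → ¬ EFEquiv 3 (LHS (suc k) (suc l) (suc m)) (ω^ (suc n))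
  l>1 (s≤s (s≤s {n = q} z≤n)) = ω*-exponent-above-1 (suc k) q (suc m) n

  k>1 : suc l ≡ 1 → suc m ≡ suc n → 1 < suc k → ¬ EFEquiv 6 (LHS (suc k) (suc l) (suc m)) (ω^ (suc n))
  k>1 refl _ (s≤s (s≤s {n = k'} z≤n)) = FiveMoves.five-moves k' (suc m) n 1
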